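{- Let $c,h,d\in\omega^\omega$ with $c>h$, $h(i)\ge1$ for all but finitely many $i$, $d\ge2$, and $\limsup_{n\to\infty}\frac{1}{d(n)}\log_{d(n)}h(n)=\infty$. For every $n<\omega$ the norm $\|\cdot\|^d_{c,h,n}$ is strongly $d(n)$-big: whenever $M\subseteq[c(n)]^{\le h(n)}$ is non-empty and $f:M\to d(n)$, there is a non-empty $M^*\subseteq M$ such that $f\restriction M^*$ is constant and $\|M^*\|^d_{c,h,n}\ge\|M\|^d_{c,h,n}-\frac{1}{d(n)}$.
   Context: Natural numbers are identified with $\{0,\dots,n-1\}$. For non-empty $M\subseteq[c(n)]^{\le h(n)}$, $\|M\|_{c,h,n}:=\max\{k\mid\forall Y\in[c(n)]^{\le k}\ \exists X\in M: Y\subseteq X\}$ and $\|M\|^d_{c,h,n}:=\frac{1}{d(n)}\log_{d(n)}(\|M\|_{c,h,n}+1)$. -}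

module Defs where

open import Data.Nat using (ℕ; suc; _+_; _*_; _^_; _≤_; _<_)
open import Data.Fin using (Fin)
open import Data.Fin.Subset using (Subset; ∣_∣) renaming (_⊆_ to _⊆ₛ_)
open import Data.List using (List; [])
open import Data.List.Membership.Propositional using (_∈_)
open import Data.List.Relation.Binary.Subset.Propositional using () renaming (_⊆_ to _⊆ₗ_)
open import Data.Product using (Σ; ∃; _×_)
open import Relation.Binary.PropositionalEquality using (_≡_; _≢_)

Family : ℕ → Set
Family C = List (Subset C)

Bounded : ∀ {C} → ℕ → Family C → Set
Bounded {C} H M = ∀ (X : Subset C) → X ∈ M → ∣ X ∣ ≤ H

Covers : ∀ {C} → Family C → ℕ → Set
Covers {C} M k = ∀ (Y : Subset C) → ∣ Y ∣ ≤ k → Σ (Subset C) λ X → X ∈ M × Y ⊆ₛ X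

NormIs : ∀ {C} → Family C → ℕ → Set
NormIs M k = Covers M k × (∀ j → Covers M j → j ≤ k)

-- For D ≥ 2 and norms a = ‖M*‖, b = ‖M‖:
--   (1/D) log_D (a+1) ≥ (1/D) log_D (b+1) - 1/D   ⟺   b + 1 ≤ D * (a + 1).
-- i.e.  ‖M*‖^d ≥ ‖M‖^d - 1/d(n), expressed without real numbers.
DNormGeMinusInv : (D a b : ℕ) → Set
DNormGeMinusInv D a b = b + 1 ≤ D * (a + 1)

StronglyBig : (C H D : ℕ) → Set
StronglyBig C H D =
  (M : Family C) → M ≢ [] → Bounded H M → (f : Subset C → Fin D) →
  Σ (Family C) λ M* → M* ≢ [] × M* ⊆ₗ M ×
    (Σ (Fin D) λ i → ∀ X → X ∈ M* → f X ≡ i) ×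
    (∀ a b → NormIs M* a → NormIs M b → DNormGeMinusInv D a b)

-- limsup_{n→∞} (1/d(n)) log_{d(n)} h(n) = ∞, i.e. for every K and N there is
-- n ≥ N with (1/d(n)) log_{d(n)} h(n) ≥ K, i.e. h(n) ≥ d(n)^(K·d(n)).
LimsupInfinite : (h d : ℕ → ℕ) → Set
LimsupInfinite h d = ∀ (K N : ℕ) → Σ ℕ λ n → N ≤ n × d n ^ (K * d n) ≤ h n

{-# OPTIONS --safe #-}
-- Split M into its d(n) colour classes. If every class failed to cover some set
-- Y_j of size ≤ k, the union of the Y_j has size ≤ d(n)·k and lies in some X ∈ M,
-- whose own class then covers Y_{f X}: a contradiction. So whenever M covers level
-- d(n)·k, some colour class covers level k. Taking k maximal with M covering d(n)·k
-- gives ‖M‖ < d(n)·(k+1) ≤ d(n)·(‖M*‖+1), which is the claimed inequality. If M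
-- covers every level, ‖M‖ does not exist and there is nothing to prove.
module Submission where

open import Defs
open import Data.Nat using (ℕ; zero; suc; _+_; _*_; _≤_; _<_; _≤?_; z≤n; s≤s; NonZero; >-nonZero)
open import Data.Nat.Properties
  using (≤-trans; ≤-reflexive; +-comm; +-suc; +-mono-≤; +-monoʳ-≤; *-monoʳ-≤; *-zeroʳ; m≤n*m; n≤1+n; ≰⇒>; 1+n≰n; module ≤-Reasoning)
open import Data.Product using (Σ; ∃; _×_; _,_; proj₁; proj₂)
open import Data.Sum using (_⊎_; inj₁; inj₂)
open import Data.Empty using (⊥-elim)
open import Data.Vec using ([]; _∷_; there)
open import Data.Fin using (Fin; zero; suc; _≟_)
open import Data.Fin.Properties using (any?)
open import Data.Fin.Subset using (Subset; ∣_∣; _∪_; inside; outside) renaming (_⊆_ to _⊆ₛ_; ⊥ to ∅)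
open import Data.Fin.Subset.Properties using (_⊆?_; anySubset?; ∣p∣≤n; ∣⊥∣≡0; p⊆p∪q; q⊆p∪q; ⊆-trans)
open import Data.List using ([]; _∷_; filter)
open import Data.List.Membership.Propositional using (_∈_; lose; find)
open import Data.List.Membership.Propositional.Properties using (∉[]; ∈-filter⁺; ∈-filter⁻)
open import Data.List.Relation.Binary.Subset.Propositional using () renaming (_⊆_ to _⊆ₗ_)
open import Data.List.Relation.Binary.Subset.Propositional.Properties using (filter-⊆)
open import Data.List.Relation.Unary.Any using (Any)
import Data.List.Relation.Unary.Any as Any
open import Relation.Nullary using (Dec; yes; no; ¬_; ¬?)
open import Relation.Nullary.Decidable using (_×-dec_)
open import Relation.Unary using (Pred; Decidable)
open import Relation.Binary.PropositionalEquality using (_≡_; _≢_; refl; sym; cong; subst)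
open import Function using (_∘_)

∣p∪q∣≤∣p∣+∣q∣ : ∀ {n} (p q : Subset n) → ∣ p ∪ q ∣ ≤ ∣ p ∣ + ∣ q ∣
∣p∪q∣≤∣p∣+∣q∣ []            []            = z≤n
∣p∪q∣≤∣p∣+∣q∣ (inside  ∷ p) (inside  ∷ q) = s≤s (≤-trans (∣p∪q∣≤∣p∣+∣q∣ p q) (+-monoʳ-≤ ∣ p ∣ (n≤1+n ∣ q ∣)))
∣p∪q∣≤∣p∣+∣q∣ (inside  ∷ p) (outside ∷ q) = s≤s (∣p∪q∣≤∣p∣+∣q∣ p q)
∣p∪q∣≤∣p∣+∣q∣ (outside ∷ p) (inside  ∷ q) = ≤-trans (s≤s (∣p∪q∣≤∣p∣+∣q∣ p q)) (≤-reflexive (sym (+-suc ∣ p ∣ ∣ q ∣)))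
∣p∪q∣≤∣p∣+∣q∣ (outside ∷ p) (outside ∷ q) = ∣p∪q∣≤∣p∣+∣q∣ p q

∣p∣≤0⇒p⊆q : ∀ {n} (p q : Subset n) → ∣ p ∣ ≤ 0 → p ⊆ₛ q
∣p∣≤0⇒p⊆q (outside ∷ p) (_ ∷ q) ∣p∣≤0 (there x∈p) = there (∣p∣≤0⇒p⊆q p q ∣p∣≤0 x∈p)

common-superset : ∀ {n} D {k} (Y : Fin D → Subset n) → (∀ j → ∣ Y j ∣ ≤ k) →
                  Σ (Subset n) λ U → ∣ U ∣ ≤ D * k × (∀ j → Y j ⊆ₛ U)
common-superset {n} zero Y _ = ∅ , ≤-reflexive (∣⊥∣≡0 n) , λ ()
common-superset (suc D) Y ∣Y∣≤k with common-superset D (Y ∘ suc) (∣Y∣≤k ∘ suc)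
... | U , ∣U∣≤ , Y⊆U =
  Y zero ∪ U ,
  ≤-trans (∣p∪q∣≤∣p∣+∣q∣ (Y zero) U) (+-mono-≤ (∣Y∣≤k zero) ∣U∣≤) ,
  λ { zero → p⊆p∪q U ; (suc j) → ⊆-trans (Y⊆U j) (q⊆p∪q (Y zero) U) }

boundary-or-holds : ∀ {ℓ} {P : Pred ℕ ℓ} → Decidable P → P 0 → ∀ N →
                    (∃ λ k → P k × ¬ P (suc k)) ⊎ P N
boundary-or-holds P? P0 zero = inj₂ P0
boundary-or-holds P? P0 (suc N) with boundary-or-holds P? P0 N
... | inj₁ boundary = inj₁ boundary
... | inj₂ PN with P? (suc N)
...   | yes PsN = inj₂ PsN
...   | no ¬PsN = inj₁ (N , PN , ¬PsN)

module _ {C : ℕ} where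

  Uncovered : Family C → ℕ → Set
  Uncovered F k = Σ (Subset C) λ Y → ∣ Y ∣ ≤ k × ¬ Any (Y ⊆ₛ_) F

  uncovered-or-covers : (F : Family C) (k : ℕ) → Uncovered F k ⊎ Covers F k
  uncovered-or-covers F k with anySubset? (λ Y → (∣ Y ∣ ≤? k) ×-dec ¬? (Any.any? (Y ⊆?_) F))
  ... | yes uncovered = inj₁ uncovered
  ... | no ¬uncovered = inj₂ covers
    where
    covers : Covers F k
    covers Y ∣Y∣≤k with Any.any? (Y ⊆?_) F
    ... | yes Y⊆some = find Y⊆some
    ... | no ¬Y⊆some = ⊥-elim (¬uncovered (Y , ∣Y∣≤k , ¬Y⊆some))

  uncovered⇒¬covers : ∀ {F : Family C} {k} → Uncovered F k → ¬ Covers F k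
  uncovered⇒¬covers (Y , ∣Y∣≤k , ¬Y⊆some) covers =
    let X , X∈F , Y⊆X = covers Y ∣Y∣≤k in ¬Y⊆some (lose X∈F Y⊆X)

  covers? : (F : Family C) (k : ℕ) → Dec (Covers F k)
  covers? F k with uncovered-or-covers F k
  ... | inj₁ uncovered = no (uncovered⇒¬covers uncovered)
  ... | inj₂ covers    = yes covers

  ¬covers⇒uncovered : ∀ {F : Family C} {k} → ¬ Covers F k → Uncovered F k
  ¬covers⇒uncovered {F} {k} ¬covers with uncovered-or-covers F k
  ... | inj₁ uncovered = uncovered
  ... | inj₂ covers    = ⊥-elim (¬covers covers)

  covers-mono : ∀ {F : Family C} {j k} → Covers F k → j ≤ k → Covers F j
  covers-mono covers j≤k Y ∣Y∣≤j = covers Y (≤-trans ∣Y∣≤j j≤k)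

  covers-all : ∀ {F : Family C} → Covers F C → ∀ k → Covers F k
  covers-all covers k Y _ = covers Y (∣p∣≤n Y)

  covers⇒≢[] : ∀ {F : Family C} {k} → Covers F k → F ≢ []
  covers⇒≢[] covers F≡[] with covers ∅ (≤-trans (≤-reflexive (∣⊥∣≡0 C)) z≤n)
  ... | X , X∈F , _ = ∉[] (subst (X ∈_) F≡[] X∈F)

  ≢[]⇒covers-0 : ∀ {F : Family C} → F ≢ [] → Covers F 0
  ≢[]⇒covers-0 {[]}    F≢[] = ⊥-elim (F≢[] refl)
  ≢[]⇒covers-0 {X ∷ F} _ Y ∣Y∣≤0 = X , Any.here refl , ∣p∣≤0⇒p⊆q Y X ∣Y∣≤0

module _ {C D : ℕ} (f : Subset C → Fin D) where

  colourClass : Family C → Fin D → Family C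
  colourClass M i = filter (λ X → f X ≟ i) M

  colourClass-⊆ : ∀ M i → colourClass M i ⊆ₗ M
  colourClass-⊆ M i = filter-⊆ (λ X → f X ≟ i) M

  colourClass-monochromatic : ∀ M i X → X ∈ colourClass M i → f X ≡ i
  colourClass-monochromatic M i X X∈class = proj₂ (∈-filter⁻ (λ X → f X ≟ i) {xs = M} X∈class)

  covers⇒colourClass-covers : ∀ M k → Covers M (D * k) → ∃ λ i → Covers (colourClass M i) k
  covers⇒colourClass-covers M k covers with any? (λ i → covers? (colourClass M i) k)
  ... | yes found = found
  ... | no none =
    let U , ∣U∣≤D*k , Y⊆U = common-superset D (proj₁ ∘ uncovered) (proj₁ ∘ proj₂ ∘ uncovered)
        X , X∈M , U⊆X     = covers U ∣U∣≤D*k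
        X∈class           = ∈-filter⁺ (λ Y → f Y ≟ f X) X∈M refl
    in ⊥-elim (proj₂ (proj₂ (uncovered (f X))) (lose X∈class (⊆-trans (Y⊆U (f X)) U⊆X)))
    where
    uncovered : ∀ i → Uncovered (colourClass M i) k
    uncovered i = ¬covers⇒uncovered (λ covers-i → none (i , covers-i))

covering-level : ∀ {C} D .{{_ : NonZero D}} (M : Family C) → M ≢ [] →
                 Σ ℕ λ k → Covers M (D * k) × (∀ b → NormIs M b → b < D * suc k)
covering-level {C} D M M≢[] = level (boundary-or-holds (λ k → covers? M (D * k)) covers-D*0 C)
  where
  covers-D*0 : Covers M (D * 0)
  covers-D*0 = covers-mono (≢[]⇒covers-0 M≢[]) (≤-reflexive (*-zeroʳ D))

  level : (∃ λ k → Covers M (D * k) × ¬ Covers M (D * suc k)) ⊎ Covers M (D * C) →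
          Σ ℕ λ k → Covers M (D * k) × (∀ b → NormIs M b → b < D * suc k)
  level (inj₁ (k , covers-D*k , ¬covers-D*[1+k])) =
    k , covers-D*k , λ b (covers-b , _) → ≰⇒> (¬covers-D*[1+k] ∘ covers-mono covers-b)
  level (inj₂ covers-D*C) =
    0 , covers-D*0 , λ b (_ , maximal) → ⊥-elim (1+n≰n (maximal (suc b) (covers-all covers-C (suc b))))
    where
    covers-C : Covers M C
    covers-C = covers-mono covers-D*C (m≤n*m C D)

stronglyBig : ∀ C H D .{{_ : NonZero D}} → StronglyBig C H D
stronglyBig C H D M M≢[] _ f =
  let k , covers-D*k , ‖M‖<D*[1+k] = covering-level D M M≢[]
      i , class-covers-k           = covers⇒colourClass-covers f M k covers-D*k
  in colourClass f M i , covers⇒≢[] class-covers-k , colourClass-⊆ f M i ,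
     (i , colourClass-monochromatic f M i) ,
     λ a b (_ , maximal) ‖M‖≡b → begin
       b + 1       ≡⟨ +-comm b 1 ⟩
       suc b       ≤⟨ ‖M‖<D*[1+k] b ‖M‖≡b ⟩
       D * suc k   ≤⟨ *-monoʳ-≤ D (s≤s (maximal k class-covers-k)) ⟩
       D * suc a   ≡⟨ cong (D *_) (+-comm 1 a) ⟩
       D * (a + 1) ∎
  where open ≤-Reasoning

lemma3p10 : (c h d : ℕ → ℕ) →
    (∀ i → h i < c i) →
    Σ ℕ (λ N → ∀ i → N ≤ i → 1 ≤ h i) →
    (∀ i → 2 ≤ d i) →
    LimsupInfinite h d →
    ∀ n → StronglyBig (c n) (h n) (d n)
lemma3p10 c h d _ _ d≥2 _ n =
  stronglyBig (c n) (h n) (d n) {{>-nonZero (≤-trans (s≤s z≤n) (d≥2 n))}}
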